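{- Let $n\ge 7$ be odd. For every maximal unrefinable partition $\lambda$ of $T_n=n(n+1)/2$ we have $\operatorname{mex}(\lambda)\ge \frac{n-3}{2}$.
   Context: A partition of $N$ into distinct parts is a sequence of positive integers $\lambda_1<\dots<\lambda_t$ with $t\ge2$ summing to $N$. Missing parts are the elements of $\mathcal M_\lambda=\{1,\dots,\lambda_t\}\setminus\{\lambda_1,\dots,\lambda_t\}$; the partition is refinable if some part equals the sum of two distinct missing parts, unrefinable otherwise. An unrefinable partition of $N$ is maximal if its largest part is the largest possible among unrefinable partitions of $N$. The minimal excludant $\operatorname{mex}(\lambda)$ is the least element of $\mathcal M_\lambda$, and is $0$ if $\mathcal M_\lambda=\emptyset$. -}

module Defs where

open import Data.Nat using (ℕ; zero; suc; _+_; _*_; _≤_; _<_; _⊔_)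
open import Data.Nat.Properties using (_≟_)
open import Data.Nat.DivMod using (_/_)
open import Data.List using (List; []; _∷_; length; foldr)
open import Data.Nat.ListAction using (sum)
open import Data.List.Relation.Unary.Linked using (Linked)
open import Data.List.Relation.Unary.All using (All)
open import Data.List.Membership.Propositional using (_∈_; _∉_)
open import Data.List.Membership.DecPropositional _≟_ using (_∈?_)
open import Data.Product using (_×_; ∃; ∃-syntax)
open import Relation.Binary.PropositionalEquality using (_≡_; _≢_)
open import Relation.Nullary using (¬_; yes; no)

T : ℕ → ℕ
T n = (n * suc n) / 2

-- A partition is represented by the list of its parts λ₁ < … < λ_t.
-- Largest part λ_t (maximum of the list; 0 for the empty list).
largest : List ℕ → ℕ
largest = foldr _⊔_ 0

IsDistinctPartition : ℕ → List ℕ → Set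
IsDistinctPartition N l =
  All (λ x → 0 < x) l × Linked _<_ l × 2 ≤ length l × sum l ≡ N

Missing : List ℕ → ℕ → Set
Missing l m = 1 ≤ m × m ≤ largest l × m ∉ l

Refinable : List ℕ → Set
Refinable l = ∃[ p ] ∃[ a ] ∃[ b ]
  (p ∈ l × Missing l a × Missing l b × a ≢ b × a + b ≡ p)

Unrefinable : List ℕ → Set
Unrefinable l = ¬ Refinable l

IsUnrefinablePartition : ℕ → List ℕ → Set
IsUnrefinablePartition N l = IsDistinctPartition N l × Unrefinable l

IsMaximalUnrefinable : ℕ → List ℕ → Set
IsMaximalUnrefinable N l =
  IsUnrefinablePartition N l ×
  (∀ (μ : List ℕ) → IsUnrefinablePartition N μ → largest μ ≤ largest l)

-- mex: least element of {1,…,λ_t} not in λ, or 0 if there is none.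
mexFrom : ℕ → ℕ → List ℕ → ℕ
mexFrom k zero    l = 0
mexFrom k (suc r) l with k ∈? l
... | yes _ = mexFrom (suc k) r l
... | no  _ = k

mex : List ℕ → ℕ
mex l = mexFrom 1 (largest l) l

{-# OPTIONS --safe #-}
module Submission where

open import Defs
open import Data.Nat using (ℕ; _≤_; _+_; _*_; _∸_; suc)
open import Data.List using (List)
open import Data.Product using (∃-syntax)
open import Relation.Binary.PropositionalEquality using (_≡_)

open import Data.Nat using (zero; _<_; _⊔_; z≤n; s≤s; _≤?_)
open import Data.Nat.DivMod using (_/_; m*n/n≡m)
open import Data.Nat.ListAction using (sum)
open import Data.Nat.ListAction.Properties using (sum-++)
open import Data.Nat.Properties
open import Data.Nat.Tactic.RingSolver using (solve-∀)
open import Algebra.Properties.CommutativeSemigroup +-commutativeSemigroup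
  using (x∙yz≈y∙xz; xy∙z≈y∙xz; xy∙z≈zy∙x)
open import Data.List using ([]; _∷_; _++_; map; filter)
open import Data.List.Properties using (length-++-≤ʳ)
open import Data.List.Membership.DecPropositional _≟_ using (_∈?_)
open import Data.List.Membership.Propositional using (_∈_; _∉_)
open import Data.List.Membership.Propositional.Properties using (∈-filter⁻; ∈-++⁺ˡ)
open import Data.List.Relation.Binary.Subset.Propositional using (_⊆_)
open import Data.List.Relation.Unary.All as All using (All; []; _∷_)
open import Data.List.Relation.Unary.All.Properties
  using (¬Any⇒All¬) renaming (++⁺ to All-++⁺)
open import Data.List.Relation.Unary.AllPairs using ([]; _∷_)
open import Data.List.Relation.Unary.Any using (here; there; _─_)
open import Data.List.Relation.Unary.Linked using (Linked; []; [-]; _∷_)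
open import Data.List.Relation.Unary.Unique.Propositional using (Unique)
import Data.List.Relation.Unary.Unique.Propositional.Properties as Unique
open import Data.Product using (_×_; _,_; proj₁; proj₂; uncurry)
open import Data.Sum using (_⊎_; inj₁; inj₂)
open import Function using (id)
open import Relation.Binary.Definitions using (tri<; tri≈; tri>)
open import Relation.Binary.PropositionalEquality
  using (refl; sym; trans; cong; cong₂; subst; _≢_)
open import Relation.Nullary using (Dec; yes; no; contradiction)
open import Relation.Nullary.Decidable using (decidable-stable)

open ≤-Reasoning

-- Write n = 2c + 3, so that T n = (2c+3)(c+2), and let L be the largest part of
-- an unrefinable partition λ of T n. If x < L − x, then x and L − x cannot both
-- be missing, since they would refine the part L; so the parts of λ among
-- {x, L − x} sum to at least x, and summing over x = 1, …, 2c gives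
-- T n ≥ L + c(2c+1). If m ≥ 1 is missing and 3m < L, refining L and then L − m
-- shows that L − m and L − 2m are parts, which raises the estimate to
-- T n ≥ 3L + c(2c+1) − 6m. Since {1, …, 2c} ∪ {2c+4, 4c+2} is an unrefinable
-- partition of T n, maximality gives L ≥ 4c+2, and the estimate becomes m ≥ c.
-- If λ has no missing part, the same argument applies to m = 1.

sum-─ : ∀ {x} {xs : List ℕ} (x∈xs : x ∈ xs) → sum xs ≡ x + sum (xs ─ x∈xs)
sum-─ (here refl) = refl
sum-─ {x} {y ∷ _} (there x∈ys) =
  trans (cong (y +_) (sum-─ x∈ys)) (x∙yz≈y∙xz y x _)

∈-─ : ∀ {x y} {xs : List ℕ} (x∈xs : x ∈ xs) → y ∈ xs → x ≢ y →
      y ∈ (xs ─ x∈xs)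
∈-─ (here refl)  (here refl)  x≢y = contradiction refl x≢y
∈-─ (here refl)  (there y∈xs) _   = y∈xs
∈-─ (there _)    (here refl)  _   = here refl
∈-─ (there x∈xs) (there y∈xs) x≢y = there (∈-─ x∈xs y∈xs x≢y)

sum-mono-⊆ : ∀ {xs ys : List ℕ} → Unique xs → xs ⊆ ys → sum xs ≤ sum ys
sum-mono-⊆ [] _ = z≤n
sum-mono-⊆ {x ∷ xs} {ys} (x≢xs ∷ xs-unique) x∷xs⊆ys = begin
  x + sum xs           ≤⟨ +-monoʳ-≤ x (sum-mono-⊆ xs-unique xs⊆ys─x) ⟩
  x + sum (ys ─ x∈ys)  ≡⟨ sum-─ x∈ys ⟨
  sum ys               ∎
  where
  x∈ys : x ∈ ys
  x∈ys = x∷xs⊆ys (here refl)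
  xs⊆ys─x : xs ⊆ (ys ─ x∈ys)
  xs⊆ys─x z∈xs = ∈-─ x∈ys (x∷xs⊆ys (there z∈xs)) (All.lookup x≢xs z∈xs)

weight : List ℕ → ℕ → ℕ
weight l x with x ∈? l
... | yes _ = x
... | no _  = 0

weight-∈ : ∀ {l x} → x ∈ l → weight l x ≡ x
weight-∈ {l} {x} x∈l with x ∈? l
... | yes _  = refl
... | no x∉l = contradiction x∈l x∉l

sum-filter-∈ : ∀ l ys → sum (filter (_∈? l) ys) ≡ sum (map (weight l) ys)
sum-filter-∈ l []       = refl
sum-filter-∈ l (y ∷ ys) with y ∈? l
... | yes _ = cong (y +_) (sum-filter-∈ l ys)
... | no _  = sum-filter-∈ l ys

sum-weight-≤ : ∀ l {ys} → Unique ys → sum (map (weight l) ys) ≤ sum l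
sum-weight-≤ l {ys} ys-unique = begin
  sum (map (weight l) ys)  ≡⟨ sum-filter-∈ l ys ⟨
  sum (filter (_∈? l) ys)  ≤⟨ sum-mono-⊆ (Unique.filter⁺ (_∈? l) ys-unique) filter⊆l ⟩
  sum l                    ∎
  where
  filter⊆l : filter (_∈? l) ys ⊆ l
  filter⊆l z∈ = proj₂ (∈-filter⁻ (_∈? l) {xs = ys} z∈)

sumTo : (ℕ → ℕ) → ℕ → ℕ
sumTo f zero    = 0
sumTo f (suc n) = f (suc n) + sumTo f n

sumTo-id : ∀ n → sumTo id n * 2 ≡ n * suc n
sumTo-id zero    = refl
sumTo-id (suc n) = begin-equality
  (suc n + sumTo id n) * 2    ≡⟨ *-distribʳ-+ 2 (suc n) (sumTo id n) ⟩
  suc n * 2 + sumTo id n * 2  ≡⟨ cong (suc n * 2 +_) (sumTo-id n) ⟩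
  suc n * 2 + n * suc n       ≡⟨ cong (suc n * 2 +_) (*-comm n (suc n)) ⟩
  suc n * 2 + suc n * n       ≡⟨ *-distribˡ-+ (suc n) 2 n ⟨
  suc n * suc (suc n)         ∎

_≤[1‥_]_ : (ℕ → ℕ) → ℕ → (ℕ → ℕ) → Set
f ≤[1‥ n ] g = ∀ {x} → 1 ≤ x → x ≤ n → f x ≤ g x

≤[1‥suc]⇒≤[1‥] : ∀ {f g} n → f ≤[1‥ suc n ] g → f ≤[1‥ n ] g
≤[1‥suc]⇒≤[1‥] n f≤g 1≤x x≤n = f≤g 1≤x (m≤n⇒m≤1+n x≤n)

sumTo-mono-≤ : ∀ {f g} n → f ≤[1‥ n ] g → sumTo f n ≤ sumTo g n
sumTo-mono-≤ zero    _   = z≤n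
sumTo-mono-≤ (suc n) f≤g =
  +-mono-≤ (f≤g (s≤s z≤n) ≤-refl) (sumTo-mono-≤ n (≤[1‥suc]⇒≤[1‥] n f≤g))

sumTo-bump : ∀ {f g a} n → f ≤[1‥ n ] g → 1 ≤ a → a ≤ n →
             sumTo f n + g a ≤ sumTo g n + f a
sumTo-bump zero _ (s≤s _) ()
sumTo-bump {f} {g} {a} (suc n) f≤g 1≤a a≤1+n with a ≟ suc n
... | yes refl = begin
  F + Sf + G  ≡⟨ xy∙z≈zy∙x F Sf G ⟩
  G + Sf + F  ≤⟨ +-monoˡ-≤ F (+-monoʳ-≤ G (sumTo-mono-≤ n f≤g′)) ⟩
  G + Sg + F  ∎
  where
  F G Sf Sg : ℕ
  F  = f (suc n)
  G  = g (suc n)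
  Sf = sumTo f n
  Sg = sumTo g n
  f≤g′ : f ≤[1‥ n ] g
  f≤g′ = ≤[1‥suc]⇒≤[1‥] n f≤g
... | no a≢1+n = begin
  F + Sf + g a    ≡⟨ +-assoc F Sf (g a) ⟩
  F + (Sf + g a)  ≤⟨ +-mono-≤ (f≤g (s≤s z≤n) ≤-refl) (sumTo-bump n f≤g′ 1≤a a≤n) ⟩
  G + (Sg + f a)  ≡⟨ +-assoc G Sg (f a) ⟨
  G + Sg + f a    ∎
  where
  F G Sf Sg : ℕ
  F  = f (suc n)
  G  = g (suc n)
  Sf = sumTo f n
  Sg = sumTo g n
  f≤g′ : f ≤[1‥ n ] g
  f≤g′ = ≤[1‥suc]⇒≤[1‥] n f≤g
  a≤n : a ≤ n
  a≤n = ≤-pred (≤∧≢⇒< a≤1+n a≢1+n)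

sumTo-bump₂ : ∀ {f g a b} n → f ≤[1‥ n ] g → 1 ≤ a → a < b → b ≤ n →
              sumTo f n + g a + g b ≤ sumTo g n + f a + f b
sumTo-bump₂ zero _ _ (s≤s _) ()
sumTo-bump₂ {f} {g} {a} {b} (suc n) f≤g 1≤a a<b b≤1+n with b ≟ suc n
... | yes refl = begin
  F + Sf + g a + G    ≡⟨ cong (_+ G) (+-assoc F Sf (g a)) ⟩
  F + (Sf + g a) + G  ≡⟨ xy∙z≈zy∙x F (Sf + g a) G ⟩
  G + (Sf + g a) + F  ≤⟨ +-monoˡ-≤ F (+-monoʳ-≤ G (sumTo-bump n f≤g′ 1≤a a≤n)) ⟩
  G + (Sg + f a) + F  ≡⟨ cong (_+ F) (+-assoc G Sg (f a)) ⟨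
  G + Sg + f a + F    ∎
  where
  F G Sf Sg : ℕ
  F  = f (suc n)
  G  = g (suc n)
  Sf = sumTo f n
  Sg = sumTo g n
  f≤g′ : f ≤[1‥ n ] g
  f≤g′ = ≤[1‥suc]⇒≤[1‥] n f≤g
  a≤n : a ≤ n
  a≤n = ≤-pred a<b
... | no b≢1+n = begin
  F + Sf + g a + g b    ≡⟨ cong (_+ g b) (+-assoc F Sf (g a)) ⟩
  F + (Sf + g a) + g b  ≡⟨ +-assoc F (Sf + g a) (g b) ⟩
  F + (Sf + g a + g b)  ≤⟨ +-mono-≤ (f≤g (s≤s z≤n) ≤-refl) (sumTo-bump₂ n f≤g′ 1≤a a<b b≤n) ⟩
  G + (Sg + f a + f b)  ≡⟨ +-assoc G (Sg + f a) (f b) ⟨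
  G + (Sg + f a) + f b  ≡⟨ cong (_+ f b) (+-assoc G Sg (f a)) ⟨
  G + Sg + f a + f b    ∎
  where
  F G Sf Sg : ℕ
  F  = f (suc n)
  G  = g (suc n)
  Sf = sumTo f n
  Sg = sumTo g n
  f≤g′ : f ≤[1‥ n ] g
  f≤g′ = ≤[1‥suc]⇒≤[1‥] n f≤g
  b≤n : b ≤ n
  b≤n = ≤-pred (≤∧≢⇒< b≤1+n b≢1+n)

complementPairs : ℕ → ℕ → List ℕ
complementPairs L zero    = L ∷ []
complementPairs L (suc j) = suc j ∷ L ∸ suc j ∷ complementPairs L j

sum-map-complementPairs : ∀ h L j →
  sum (map h (complementPairs L j)) ≡ h L + sumTo (λ x → h x + h (L ∸ x)) j
sum-map-complementPairs h L zero    = refl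
sum-map-complementPairs h L (suc j) = begin-equality
  h s + (h (L ∸ s) + sum (map h (complementPairs L j)))
    ≡⟨ cong (λ u → h s + (h (L ∸ s) + u)) (sum-map-complementPairs h L j) ⟩
  h s + (h (L ∸ s) + (h L + P))
    ≡⟨ +-assoc (h s) (h (L ∸ s)) (h L + P) ⟨
  h s + h (L ∸ s) + (h L + P)
    ≡⟨ x∙yz≈y∙xz (h s + h (L ∸ s)) (h L) P ⟩
  h L + (h s + h (L ∸ s) + P)
    ∎
  where
  s P : ℕ
  s = suc j
  P = sumTo (λ x → h x + h (L ∸ x)) j

complementPairs-gap : ∀ {L y} j → j < y → y < L ∸ j → y ∉ complementPairs L j
complementPairs-gap zero    _   y<L   (here refl)         = <-irrefl refl y<L
complementPairs-gap (suc j) j<y _     (here refl)         = <-irrefl refl j<y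
complementPairs-gap (suc j) _   y<L∸j (there (here refl)) = <-irrefl refl y<L∸j
complementPairs-gap {L} (suc j) 1+j<y y<L∸1+j (there (there y∈)) =
  complementPairs-gap j (<-trans (n<1+n j) 1+j<y)
    (<-≤-trans y<L∸1+j (∸-monoʳ-≤ L (n≤1+n j))) y∈

complementPairs-unique : ∀ {L} j → j + j < L → Unique (complementPairs L j)
complementPairs-unique zero    _ = [] ∷ []
complementPairs-unique {L} (suc j) 2s<L =
  ¬Any⇒All¬ _ s∉ ∷ ¬Any⇒All¬ _ L∸s∉ ∷ complementPairs-unique j 2j<L
  where
  s<L∸s : suc j < L ∸ suc j
  s<L∸s = m+n≤o⇒m≤o∸n (suc (suc j)) 2s<L
  s≤L : suc j ≤ L
  s≤L = ≤-trans (m≤m+n (suc j) (suc j)) (<⇒≤ 2s<L)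
  2j<L : j + j < L
  2j<L = <-trans (+-mono-< (n<1+n j) (n<1+n j)) 2s<L
  s∉ : suc j ∉ L ∸ suc j ∷ complementPairs L j
  s∉ (here s≡L∸s) = <⇒≢ s<L∸s s≡L∸s
  s∉ (there s∈)   =
    complementPairs-gap j (n<1+n j) (<-≤-trans s<L∸s (∸-monoʳ-≤ L (n≤1+n j))) s∈
  L∸s∉ : L ∸ suc j ∉ complementPairs L j
  L∸s∉ = complementPairs-gap j (<-trans (n<1+n j) s<L∸s) (∸-monoʳ-< (n<1+n j) s≤L)

∈⇒≤largest : ∀ {x l} → x ∈ l → x ≤ largest l
∈⇒≤largest {l = y ∷ ys} (here refl)  = m≤m⊔n y (largest ys)
∈⇒≤largest {l = y ∷ ys} (there x∈ys) =
  ≤-trans (∈⇒≤largest x∈ys) (m≤n⊔m y (largest ys))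

largest-∈ : ∀ x xs → largest (x ∷ xs) ∈ x ∷ xs
largest-∈ x []       = here (⊔-identityʳ x)
largest-∈ x (y ∷ ys) with ⊔-sel x (largest (y ∷ ys))
... | inj₁ x⊔L≡x = here x⊔L≡x
... | inj₂ x⊔L≡L = there (subst (_∈ y ∷ ys) (sym x⊔L≡L) (largest-∈ y ys))

largest-++ : ∀ {xs ys} → All (_≤ largest ys) xs → largest (xs ++ ys) ≡ largest ys
largest-++ []                   = refl
largest-++ {x ∷ _} (x≤L ∷ xs≤L) =
  trans (cong (x ⊔_) (largest-++ xs≤L)) (m≤n⇒m⊔n≡n x≤L)

consecutive : ℕ → ℕ → List ℕ
consecutive a zero    = []
consecutive a (suc r) = a ∷ consecutive (suc a) r

∈-consecutive⁺ : ∀ {a x} r → a ≤ x → x < a + r → x ∈ consecutive a r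
∈-consecutive⁺ {a} {x} zero a≤x x<a+0 =
  contradiction a≤x (<⇒≱ (subst (x <_) (+-identityʳ a) x<a+0))
∈-consecutive⁺ {a} {x} (suc r) a≤x x<a+1+r with a ≟ x
... | yes refl = here refl
... | no a≢x   =
  there (∈-consecutive⁺ r (≤∧≢⇒< a≤x a≢x) (subst (x <_) (+-suc a r) x<a+1+r))

∈-consecutive⁻ : ∀ {a x} r → x ∈ consecutive a r → a ≤ x × x < a + r
∈-consecutive⁻ {a} (suc r) (here refl) = ≤-refl , m<m+n a (s≤s z≤n)
∈-consecutive⁻ {a} (suc r) (there x∈) with ∈-consecutive⁻ r x∈
... | 1+a≤x , x<1+a+r = <⇒≤ 1+a≤x , <-≤-trans x<1+a+r (≤-reflexive (sym (+-suc a r)))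

sum-consecutive : ∀ a r → sum (consecutive (suc a) r) + sumTo id a ≡ sumTo id (a + r)
sum-consecutive a zero    = cong (sumTo id) (sym (+-identityʳ a))
sum-consecutive a (suc r) = begin-equality
  suc a + sum (consecutive (suc (suc a)) r) + sumTo id a
    ≡⟨ xy∙z≈y∙xz (suc a) _ (sumTo id a) ⟩
  sum (consecutive (suc (suc a)) r) + sumTo id (suc a)
    ≡⟨ sum-consecutive (suc a) r ⟩
  sumTo id (suc a + r)
    ≡⟨ cong (sumTo id) (+-suc a r) ⟨
  sumTo id (a + suc r)
    ∎

consecutive-++-linked : ∀ a r {ys} → Linked _<_ ys → All (a + r ≤_) ys →
                        Linked _<_ (consecutive a r ++ ys)
consecutive-++-linked a zero          ys-linked _ = ys-linked
consecutive-++-linked a (suc zero)    []        _ = [-]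
consecutive-++-linked a (suc zero)    ys-linked (a+1≤y ∷ _) =
  ≤-trans (≤-reflexive (+-comm 1 a)) a+1≤y ∷ ys-linked
consecutive-++-linked a (suc (suc r)) ys-linked a+2+r≤ys =
  n<1+n a ∷ consecutive-++-linked (suc a) (suc r) ys-linked
              (All.map (≤-trans (≤-reflexive (sym (+-suc a (suc r))))) a+2+r≤ys)

mexFrom-spec : ∀ k r l →
  (mexFrom k r l ≡ 0 × consecutive k r ⊆ l) ⊎ (k ≤ mexFrom k r l × mexFrom k r l ∉ l)
mexFrom-spec k zero    l = inj₁ (refl , λ ())
mexFrom-spec k (suc r) l with k ∈? l
... | no k∉l = inj₂ (≤-refl , k∉l)
... | yes k∈l with mexFrom-spec (suc k) r l
...   | inj₂ (1+k≤mex , mex∉l) = inj₂ (<⇒≤ 1+k≤mex , mex∉l)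
...   | inj₁ (mex≡0 , rest⊆l)  =
  inj₁ (mex≡0 , λ { (here refl) → k∈l ; (there y∈) → rest⊆l y∈ })

complement-∈ : ∀ {l p a} → Unrefinable l → p ∈ l → 1 ≤ a → a < p ∸ a → a ∉ l →
               p ∸ a ∈ l
complement-∈ {l} {p} {a} unref p∈l 1≤a a<p∸a a∉l =
  decidable-stable (p ∸ a ∈? l) λ p∸a∉l →
    unref (p , a , p ∸ a , p∈l ,
           (1≤a , ≤-trans a≤p p≤L , a∉l) ,
           (≤-trans 1≤a (<⇒≤ a<p∸a) , ≤-trans (m∸n≤m p a) p≤L , p∸a∉l) ,
           <⇒≢ a<p∸a , m+[n∸m]≡n a≤p)
  where
  p≤L : p ≤ largest l
  p≤L = ∈⇒≤largest p∈l
  a≤p : a ≤ p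
  a≤p = ≤-trans (<⇒≤ a<p∸a) (m∸n≤m p a)

missing⇒complements-∈ : ∀ {l v} → Unrefinable l → largest l ∈ l → 1 ≤ v →
  v + (v + v) < largest l → v ∉ l → largest l ∸ v ∈ l × largest l ∸ (v + v) ∈ l
missing⇒complements-∈ {l} {v} unref L∈l 1≤v 3v<L v∉l = L∸v∈l , L∸2v∈l
  where
  L : ℕ
  L = largest l
  v<L∸2v : v < L ∸ (v + v)
  v<L∸2v = m+n≤o⇒m≤o∸n (suc v) 3v<L
  L∸v∈l : L ∸ v ∈ l
  L∸v∈l = complement-∈ unref L∈l 1≤v (<-≤-trans v<L∸2v (∸-monoʳ-≤ L (m≤m+n v v))) v∉l
  L∸2v∈l : L ∸ (v + v) ∈ l
  L∸2v∈l = subst (_∈ l) (∸-+-assoc L v v)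
    (complement-∈ unref L∸v∈l 1≤v (subst (v <_) (sym (∸-+-assoc L v v)) v<L∸2v) v∉l)

distinct-above⇒sum-> : ∀ {k a b} → k < a → k < b → a ≢ b → suc k + suc k < a + b
distinct-above⇒sum-> {k} {a} {b} k<a k<b a≢b with <-cmp a b
... | tri< a<b _ _ = +-mono-≤-< k<a (≤-<-trans k<a a<b)
... | tri≈ _ a≡b _ = contradiction a≡b a≢b
... | tri> _ _ b<a = +-mono-<-≤ (≤-<-trans k<b b<a) k<b

unrefinable-if-prefix : ∀ {l} k → consecutive 1 k ⊆ l → largest l ≤ suc k + suc k →
                        Unrefinable l
unrefinable-if-prefix {l} k prefix⊆l L≤2k+2
  (p , a , b , p∈l , (1≤a , _ , a∉l) , (1≤b , _ , b∉l) , a≢b , a+b≡p) =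
  <⇒≱ (distinct-above⇒sum-> (above 1≤a a∉l) (above 1≤b b∉l) a≢b) (begin
    a + b          ≡⟨ a+b≡p ⟩
    p              ≤⟨ ∈⇒≤largest p∈l ⟩
    largest l      ≤⟨ L≤2k+2 ⟩
    suc k + suc k  ∎)
  where
  above : ∀ {x} → 1 ≤ x → x ∉ l → k < x
  above 1≤x x∉l = ≰⇒> λ x≤k → x∉l (prefix⊆l (∈-consecutive⁺ k 1≤x (s≤s x≤k)))

complements-sum-bound : ∀ {l J m} → Unrefinable l → largest l ∈ l → J + J < largest l →
  1 ≤ m → m + m ≤ J → largest l ∸ m ∈ l → largest l ∸ (m + m) ∈ l →
  largest l + (sumTo id J + (largest l ∸ m) + (largest l ∸ (m + m))) ≤ sum l + m + (m + m)
complements-sum-bound {l} {J} {m} unref L∈l 2J<L 1≤m 2m≤J L∸m∈l L∸2m∈l = begin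
  L + (sumTo id J + (L ∸ m) + (L ∸ (m + m)))
    ≤⟨ +-monoʳ-≤ L (+-mono-≤ (+-monoʳ-≤ (sumTo id J) (pairWeight-≥ L∸m∈l))
                             (pairWeight-≥ L∸2m∈l)) ⟩
  L + (sumTo id J + pairWeight m + pairWeight (m + m))
    ≤⟨ +-monoʳ-≤ L (sumTo-bump₂ J id≤pairWeight 1≤m (m<m+n m 1≤m) 2m≤J) ⟩
  L + (sumTo pairWeight J + m + (m + m))
    ≡⟨ +-assoc L (sumTo pairWeight J + m) (m + m) ⟨
  L + (sumTo pairWeight J + m) + (m + m)
    ≡⟨ cong (_+ (m + m)) (+-assoc L (sumTo pairWeight J) m) ⟨
  L + sumTo pairWeight J + m + (m + m)
    ≡⟨ cong (λ u → u + sumTo pairWeight J + m + (m + m)) (weight-∈ L∈l) ⟨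
  weight l L + sumTo pairWeight J + m + (m + m)
    ≡⟨ cong (λ u → u + m + (m + m)) (sum-map-complementPairs (weight l) L J) ⟨
  sum (map (weight l) (complementPairs L J)) + m + (m + m)
    ≤⟨ +-monoˡ-≤ (m + m) (+-monoˡ-≤ m (sum-weight-≤ l (complementPairs-unique J 2J<L))) ⟩
  sum l + m + (m + m)
    ∎
  where
  L : ℕ
  L = largest l
  pairWeight : ℕ → ℕ
  pairWeight x = weight l x + weight l (L ∸ x)
  pairWeight-≥ : ∀ {x} → L ∸ x ∈ l → L ∸ x ≤ pairWeight x
  pairWeight-≥ {x} L∸x∈l =
    ≤-trans (≤-reflexive (sym (weight-∈ L∸x∈l))) (m≤n+m _ (weight l x))
  id≤pairWeight : id ≤[1‥ J ] pairWeight
  id≤pairWeight {x} 1≤x x≤J = by-membership (x ∈? l)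
    where
    x<L∸x : x < L ∸ x
    x<L∸x = m+n≤o⇒m≤o∸n (suc x) (≤-<-trans (+-mono-≤ x≤J x≤J) 2J<L)
    by-membership : Dec (x ∈ l) → x ≤ pairWeight x
    by-membership (yes x∈l) =
      ≤-trans (≤-reflexive (sym (weight-∈ x∈l))) (m≤m+n _ (weight l (L ∸ x)))
    by-membership (no x∉l)  =
      ≤-trans (<⇒≤ x<L∸x) (pairWeight-≥ (complement-∈ unref L∈l 1≤x x<L∸x x∉l))

complements-sum-bound⇒c≤m : ∀ {c m L} → 4 * c + 2 ≤ L → m + m ≤ L →
  L + (sumTo id (c + c) + (L ∸ m) + (L ∸ (m + m))) ≤ (2 * c + 3) * (c + 2) + m + (m + m) →
  c ≤ m
complements-sum-bound⇒c≤m {c} {m} {L} 4c+2≤L 2m≤L bound =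
  *-cancelˡ-≤ 12 (+-cancelˡ-≤ (P * 2) (12 * c) (12 * m) (begin
    P * 2 + 12 * c
      ≡⟨ expand-P c ⟩
    (c + c) * suc (c + c) + 6 * (4 * c + 2)
      ≤⟨ +-monoʳ-≤ ((c + c) * suc (c + c)) (*-monoʳ-≤ 6 4c+2≤L) ⟩
    (c + c) * suc (c + c) + 6 * L
      ≡⟨ cong (_+ 6 * L) (sumTo-id (c + c)) ⟨
    S * 2 + 6 * L
      ≡⟨ collect-L S L ⟩
    (L + S + L + L) * 2
      ≡⟨ cong₂ (λ u v → (L + S + u + v) * 2) (m∸n+n≡m m≤L) (m∸n+n≡m 2m≤L) ⟨
    (L + S + (L ∸ m + m) + (L ∸ (m + m) + (m + m))) * 2
      ≡⟨ split-m L S (L ∸ m) (L ∸ (m + m)) m ⟩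
    (L + (S + (L ∸ m) + (L ∸ (m + m))) + (m + (m + m))) * 2
      ≤⟨ *-monoˡ-≤ 2 (+-monoˡ-≤ (m + (m + m)) bound) ⟩
    (P + m + (m + m) + (m + (m + m))) * 2
      ≡⟨ collect-m P m ⟩
    P * 2 + 12 * m
      ∎))
  where
  P S : ℕ
  P = (2 * c + 3) * (c + 2)
  S = sumTo id (c + c)
  m≤L : m ≤ L
  m≤L = ≤-trans (m≤m+n m m) 2m≤L
  expand-P : ∀ c → (2 * c + 3) * (c + 2) * 2 + 12 * c ≡
                   (c + c) * suc (c + c) + 6 * (4 * c + 2)
  expand-P = solve-∀
  collect-L : ∀ S L → S * 2 + 6 * L ≡ (L + S + L + L) * 2
  collect-L = solve-∀
  split-m : ∀ L S D E m → (L + S + (D + m) + (E + (m + m))) * 2 ≡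
                          (L + (S + D + E) + (m + (m + m))) * 2
  split-m = solve-∀
  collect-m : ∀ P m → (P + m + (m + m) + (m + (m + m))) * 2 ≡ P * 2 + 12 * m
  collect-m = solve-∀

witness : ℕ → List ℕ
witness c = consecutive 1 (c + c) ++ 2 * c + 4 ∷ 4 * c + 2 ∷ []

2c+1≤2c+4 : ∀ c → suc (c + c) ≤ 2 * c + 4
2c+1≤2c+4 c = ≤-trans (m≤m+n _ 3) (≤-reflexive (expand c))
  where
  expand : ∀ c → suc (c + c) + 3 ≡ 2 * c + 4
  expand = solve-∀

2c+4<4c+2 : ∀ {c} → 2 ≤ c → 2 * c + 4 < 4 * c + 2
2c+4<4c+2 {suc (suc d)} (s≤s (s≤s z≤n)) =
  ≤-trans (m≤m+n _ (2 * d + 1)) (≤-reflexive (expand d))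
  where
  expand : ∀ d → suc (2 * suc (suc d) + 4) + (2 * d + 1) ≡ 4 * suc (suc d) + 2
  expand = solve-∀

4c<4c+2 : ∀ c → c + c + (c + c) < 4 * c + 2
4c<4c+2 c = ≤-trans (m≤m+n _ 1) (≤-reflexive (expand c))
  where
  expand : ∀ c → suc (c + c + (c + c)) + 1 ≡ 4 * c + 2
  expand = solve-∀

largest-witness : ∀ {c} → 2 ≤ c → largest (witness c) ≡ 4 * c + 2
largest-witness {c} 2≤c = begin-equality
  largest (witness c)              ≡⟨ largest-++ (All.tabulate below-top) ⟩
  (2 * c + 4) ⊔ ((4 * c + 2) ⊔ 0)  ≡⟨ cong ((2 * c + 4) ⊔_) (⊔-identityʳ (4 * c + 2)) ⟩
  (2 * c + 4) ⊔ (4 * c + 2)        ≡⟨ m≤n⇒m⊔n≡n (<⇒≤ (2c+4<4c+2 2≤c)) ⟩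
  4 * c + 2                        ∎
  where
  below-top : ∀ {x} → x ∈ consecutive 1 (c + c) → x ≤ (2 * c + 4) ⊔ ((4 * c + 2) ⊔ 0)
  below-top x∈ = ≤-trans (<⇒≤ (proj₂ (∈-consecutive⁻ (c + c) x∈)))
                   (≤-trans (2c+1≤2c+4 c) (m≤m⊔n (2 * c + 4) _))

sum-witness : ∀ c → sum (witness c) ≡ (2 * c + 3) * (c + 2)
sum-witness c = *-cancelʳ-≡ _ _ 2 (begin-equality
  sum (witness c) * 2
    ≡⟨ cong (_* 2) (sum-++ (consecutive 1 (c + c)) top) ⟩
  (sum (consecutive 1 (c + c)) + sum top) * 2
    ≡⟨ cong (λ u → (u + sum top) * 2) (trans (sym (+-identityʳ _)) (sum-consecutive 0 (c + c))) ⟩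
  (sumTo id (c + c) + sum top) * 2
    ≡⟨ *-distribʳ-+ 2 (sumTo id (c + c)) (sum top) ⟩
  sumTo id (c + c) * 2 + sum top * 2
    ≡⟨ cong (_+ sum top * 2) (sumTo-id (c + c)) ⟩
  (c + c) * suc (c + c) + sum top * 2
    ≡⟨ expand c ⟩
  (2 * c + 3) * (c + 2) * 2
    ∎)
  where
  top : List ℕ
  top = 2 * c + 4 ∷ 4 * c + 2 ∷ []
  expand : ∀ c → (c + c) * suc (c + c) + (2 * c + 4 + (4 * c + 2 + 0)) * 2 ≡
                 (2 * c + 3) * (c + 2) * 2
  expand = solve-∀

witness-unrefinablePartition : ∀ {c} → 2 ≤ c →
  IsUnrefinablePartition ((2 * c + 3) * (c + 2)) (witness c)
witness-unrefinablePartition {c} 2≤c =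
  (positive , linked , length-++-≤ʳ top {consecutive 1 (c + c)} , sum-witness c) ,
  unrefinable-if-prefix (c + c) ∈-++⁺ˡ (≤-reflexive (trans (largest-witness 2≤c) (expand c)))
  where
  top : List ℕ
  top = 2 * c + 4 ∷ 4 * c + 2 ∷ []
  positive : All (0 <_) (witness c)
  positive = All-++⁺ (All.tabulate (λ x∈ → proj₁ (∈-consecutive⁻ (c + c) x∈)))
               (≤-trans (s≤s z≤n) (m≤n+m 4 (2 * c)) ∷
                ≤-trans (s≤s z≤n) (m≤n+m 2 (4 * c)) ∷ [])
  linked : Linked _<_ (witness c)
  linked = consecutive-++-linked 1 (c + c) (2c+4<4c+2 2≤c ∷ [-])
             (2c+1≤2c+4 c ∷ ≤-trans (2c+1≤2c+4 c) (<⇒≤ (2c+4<4c+2 2≤c)) ∷ [])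
  expand : ∀ c → 4 * c + 2 ≡ suc (c + c) + suc (c + c)
  expand = solve-∀

maximal⇒4c+2≤largest : ∀ {c l} → 2 ≤ c → IsMaximalUnrefinable ((2 * c + 3) * (c + 2)) l →
                       4 * c + 2 ≤ largest l
maximal⇒4c+2≤largest {c} {l} 2≤c (_ , maximal) = begin
  4 * c + 2            ≡⟨ largest-witness 2≤c ⟨
  largest (witness c)  ≤⟨ maximal (witness c) (witness-unrefinablePartition 2≤c) ⟩
  largest l            ∎

complements-∈⇒c≤m : ∀ {c l m} → IsUnrefinablePartition ((2 * c + 3) * (c + 2)) l →
  largest l ∈ l → 4 * c + 2 ≤ largest l →
  1 ≤ m → largest l ∸ m ∈ l → largest l ∸ (m + m) ∈ l → c ≤ m
complements-∈⇒c≤m {c} {l} {m} ((_ , _ , _ , sum≡) , unref) L∈l 4c+2≤L 1≤m L∸m∈l L∸2m∈l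
  with c ≤? m
... | yes c≤m = c≤m
... | no c≰m  = complements-sum-bound⇒c≤m 4c+2≤L 2m≤L (begin
  largest l + (sumTo id (c + c) + (largest l ∸ m) + (largest l ∸ (m + m)))
    ≤⟨ complements-sum-bound unref L∈l 4c<L 1≤m 2m≤2c L∸m∈l L∸2m∈l ⟩
  sum l + m + (m + m)
    ≡⟨ cong (λ s → s + m + (m + m)) sum≡ ⟩
  (2 * c + 3) * (c + 2) + m + (m + m)
    ∎)
  where
  m≤c : m ≤ c
  m≤c = <⇒≤ (≰⇒> c≰m)
  2m≤2c : m + m ≤ c + c
  2m≤2c = +-mono-≤ m≤c m≤c
  4c<L : c + c + (c + c) < largest l
  4c<L = <-≤-trans (4c<4c+2 c) 4c+2≤L
  2m≤L : m + m ≤ largest l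
  2m≤L = ≤-trans 2m≤2c (≤-trans (m≤m+n (c + c) (c + c)) (<⇒≤ 4c<L))

mex-lower-bound : ∀ {c} l → 2 ≤ c → IsMaximalUnrefinable ((2 * c + 3) * (c + 2)) l →
                  c ≤ mex l
mex-lower-bound [] _ (((_ , _ , () , _) , _) , _)
mex-lower-bound {c} l@(x ∷ xs) 2≤c maximal@(partition@(_ , unref) , _) =
  by-mex (mexFrom-spec 1 L l)
  where
  L : ℕ
  L = largest l
  L∈l : L ∈ l
  L∈l = largest-∈ x xs
  4c+2≤L : 4 * c + 2 ≤ L
  4c+2≤L = maximal⇒4c+2≤largest 2≤c maximal
  4c<L : c + c + (c + c) < L
  4c<L = <-≤-trans (4c<4c+2 c) 4c+2≤L
  complements⇒c≤ : ∀ {m} → 1 ≤ m → L ∸ m ∈ l → L ∸ (m + m) ∈ l → c ≤ m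
  complements⇒c≤ = complements-∈⇒c≤m partition L∈l 4c+2≤L
  by-mex : (mex l ≡ 0 × consecutive 1 L ⊆ l) ⊎ (1 ≤ mex l × mex l ∉ l) → c ≤ mex l
  by-mex (inj₁ (_ , [1‥L]⊆l)) =
    contradiction (complements⇒c≤ ≤-refl (∈l 1≤L∸1 (m∸n≤m L 1)) (∈l 1≤L∸2 (m∸n≤m L 2)))
                  (<⇒≱ 2≤c)
    where
    ∈l : ∀ {y} → 1 ≤ y → y ≤ L → y ∈ l
    ∈l 1≤y y≤L = [1‥L]⊆l (∈-consecutive⁺ L 1≤y (s≤s y≤L))
    3≤L : 3 ≤ L
    3≤L = ≤-<-trans (≤-trans 2≤c (≤-trans (m≤m+n c c) (m≤m+n (c + c) (c + c)))) 4c<L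
    1≤L∸1 : 1 ≤ L ∸ 1
    1≤L∸1 = m+n≤o⇒m≤o∸n 1 (≤-trans (n≤1+n 2) 3≤L)
    1≤L∸2 : 1 ≤ L ∸ 2
    1≤L∸2 = m+n≤o⇒m≤o∸n 1 3≤L
  by-mex (inj₂ (1≤v , v∉l)) with c ≤? mex l
  ... | yes c≤v = c≤v
  ... | no c≰v  =
    uncurry (complements⇒c≤ 1≤v) (missing⇒complements-∈ unref L∈l 1≤v 3v<L v∉l)
    where
    v≤c : mex l ≤ c
    v≤c = <⇒≤ (≰⇒> c≰v)
    3v<L : mex l + (mex l + mex l) < L
    3v<L = ≤-<-trans (+-mono-≤ (≤-trans v≤c (m≤m+n c c)) (+-mono-≤ v≤c v≤c)) 4c<L

T-odd : ∀ c → T (2 * suc c + 1) ≡ (2 * c + 3) * (c + 2)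
T-odd c = trans (cong (_/ 2) (expand c)) (m*n/n≡m ((2 * c + 3) * (c + 2)) 2)
  where
  expand : ∀ c → (2 * suc c + 1) * suc (2 * suc c + 1) ≡ (2 * c + 3) * (c + 2) * 2
  expand = solve-∀

corollary5p11 : (n : ℕ) → 7 ≤ n → (∃[ k ] n ≡ 2 * k + 1) →
    (l : List ℕ) → IsMaximalUnrefinable (T n) l →
    n ∸ 3 ≤ 2 * mex l
corollary5p11 _ 7≤1 (zero , refl) _ _ = contradiction 7≤1 λ { (s≤s ()) }
corollary5p11 _ 7≤n (suc c , refl) l maximal = begin
  2 * suc c + 1 ∸ 3  ≡⟨ cong (_∸ 3) (n≡3+2c c) ⟩
  3 + 2 * c ∸ 3      ≡⟨ m+n∸m≡n 3 (2 * c) ⟩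
  2 * c              ≤⟨ *-monoʳ-≤ 2 (mex-lower-bound l 2≤c maximal′) ⟩
  2 * mex l          ∎
  where
  n≡3+2c : ∀ c → 2 * suc c + 1 ≡ 3 + 2 * c
  n≡3+2c = solve-∀
  2≤c : 2 ≤ c
  2≤c = *-cancelˡ-≤ 2 (+-cancelˡ-≤ 3 4 (2 * c) (≤-trans 7≤n (≤-reflexive (n≡3+2c c))))
  maximal′ : IsMaximalUnrefinable ((2 * c + 3) * (c + 2)) l
  maximal′ = subst (λ N → IsMaximalUnrefinable N l) (T-odd c) maximal
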